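{- The set $\mathcal I_{p,q}$ has $w_{p,q}=(1\;n)(2\;n{ - }1)\cdots(m\;n{ - }m{+}1)$, where $m=\min(p,q)$, as its unique maximal element with respect to involution weak order.
   Context: Fix integers $p,q\ge0$, $n=p+q$. Let $\mathcal I_n$ be the set of involutions in the symmetric group $S_n$, $s_i=(i\;i{+}1)$, and $\ell(w)$ the number of inversions of $w$. For $z\in\mathcal I_n$ and $1\le i<n$, $z\ast s_i=zs_i$ if $s_iz=zs_i$ and $z\ast s_i=s_izs_i$ otherwise. The (involution) weak order on $\mathcal I_n$ is the transitive closure of the relations $z\ast s_i<z$ whenever $\ell(z\ast s_i)<\ell(z)$. $\kappa(z)$ denotes the number of 2-cycles of $z$, and $\mathcal I_{p,q}=\{z\in\mathcal I_n:\kappa(z)\le\min(p,q)\}$, ordered by the restriction of weak order. -}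

module Defs where

open import Data.Nat.Properties as ℕP using (<-trans; n<1+n)
open import Data.Nat as ℕ using (ℕ; suc; _+_; _∸_; _<_; _⊓_)
open import Data.Fin as Fin using (Fin; toℕ; fromℕ<; opposite)
open import Data.Fin.Properties using () renaming (_≟_ to _≟ᶠ_)
open import Data.Vec using (Vec; lookup; tabulate)
open import Data.Vec.Properties using (≡-dec)
open import Data.List using (List; length; filter; cartesianProduct)
open import Data.List.Base using () renaming (map to lmap)
open import Data.Fin.Base using ()
open import Data.Vec.Base using (toList; allFin)
open import Data.Product using (Σ; ∃; _×_; _,_; proj₁; proj₂)
open import Data.Bool using (if_then_else_)
open import Relation.Nullary using (¬_; Dec; yes; no; _×-dec_; does)
open import Relation.Binary.PropositionalEquality using (_≡_)
open import Relation.Binary.Construct.Closure.Transitive using (TransClosure)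

-- A permutation of {0,…,n-1} in one-line notation: w is the vector (w(0),…,w(n-1)).
Perm : ℕ → Set
Perm n = Vec (Fin n) n

app : ∀ {n} → Perm n → Fin n → Fin n
app = lookup

_∘ₚ_ : ∀ {n} → Perm n → Perm n → Perm n
u ∘ₚ v = tabulate (λ k → app u (app v k))

-- w is an involution: w(w(k)) = k for all k (hence w is a permutation with w² = 1)
IsInvolution : ∀ {n} → Perm n → Set
IsInvolution {n} w = ∀ (k : Fin n) → app w (app w k) ≡ k

transp : ∀ {n} → Fin n → Fin n → Perm n
transp a b = tabulate (λ k → if does (k ≟ᶠ a) then b else (if does (k ≟ᶠ b) then a else k))

-- simple transposition s_i = (i i+1), here with 0-based index j (s_{j+1} in the paper's numbering)
s : ∀ {n} (j : ℕ) → suc j < n → Perm n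
s j h = transp (fromℕ< (<-trans (n<1+n j) h)) (fromℕ< h)

ℓ : ∀ {n} → Perm n → ℕ
ℓ {n} w = length (filter (λ ij → (proj₁ ij Fin.<? proj₂ ij) ×-dec (app w (proj₂ ij) Fin.<? app w (proj₁ ij)))
                         (cartesianProduct (toList (allFin n)) (toList (allFin n))))

_∗s_ : ∀ {n} → Perm n → (j : ℕ) → suc j < n → Perm n
(z ∗s j) h with ≡-dec _≟ᶠ_ (s j h ∘ₚ z) (z ∘ₚ s j h)
... | yes _ = z ∘ₚ s j h
... | no  _ = s j h ∘ₚ (z ∘ₚ s j h)

_⋖_ : ∀ {n} → Perm n → Perm n → Set
_⋖_ {n} z' z = IsInvolution z × Σ ℕ (λ j → Σ (suc j < n) (λ h → (z' ≡ (z ∗s j) h) × (ℓ z' < ℓ z)))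

_<ʷ_ : ∀ {n} → Perm n → Perm n → Set
_<ʷ_ = TransClosure _⋖_

-- κ(z) = number of 2-cycles = #{k : z(k) > k}
κ : ∀ {n} → Perm n → ℕ
κ {n} z = length (filter (λ k → k Fin.<? app z k) (toList (allFin n)))

InIpq : (p q : ℕ) → Perm (p + q) → Set
InIpq p q z = IsInvolution z × (κ z ℕ.≤ (p ⊓ q))

IsMaximalIpq : (p q : ℕ) → Perm (p + q) → Set
IsMaximalIpq p q z = InIpq p q z × (∀ z' → InIpq p q z' → ¬ (z <ʷ z'))

-- w_{p,q} = (1 n)(2 n-1)⋯(m n-m+1), m = min(p,q); 0-based: k ↦ n-1-k when k < m or k ≥ n-m
wpq : (p q : ℕ) → Perm (p + q)
wpq p q = tabulate (λ k → if does (toℕ k ℕ.<? (p ⊓ q)) then opposite k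
                           else (if does ((p + q) ∸ (p ⊓ q) ℕ.≤? toℕ k) then opposite k else k))

module Submission where

-- Write σ = s_j for the transposition of the adjacent positions a = j, b = j+1.
-- If an involution z has an ascent z(a) < z(b), then z ∗ s_j lies above z; it
-- has the extra 2-cycle (a b) when a and b are fixed points of z, and the same
-- number κ of 2-cycles otherwise.  Dually a step down never creates 2-cycles,
-- so κ grows along weak order.  Hence:
--  * w_{p,q} is maximal: its ascents are all pairs of fixed points, so a step
--    up from it has m+1 > m = min(p,q) 2-cycles, and so does everything above.
--  * a maximal z has only ascents between fixed points, and such an ascent
--    forces κ z = m; a combinatorial argument on involutions of {0,…,n-1}
--    (module Rigidity) then shows that z reverses the lowest and the highest
--    m positions and fixes the others, i.e. z = w_{p,q}.

open import Defs
open import Data.Nat using (ℕ)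
open import Data.Product using (_×_)
open import Relation.Binary.PropositionalEquality using (_≡_)

open import Data.Nat as ℕ using (zero; suc; _+_; _∸_; _≤_; _<_; z≤n; s≤s; _⊓_)
open import Data.Nat.Properties
open import Data.Fin as Fin using (Fin; zero; suc; toℕ; fromℕ<; opposite)
open import Data.Fin.Properties using (toℕ-injective; toℕ-fromℕ<; fromℕ<-toℕ; opposite-prop; opposite-involutive; toℕ<n)
  renaming (_≟_ to _≟ᶠ_; suc-injective to Fin-suc-injective)
open import Data.Fin.Permutation using (permutation)
open import Data.Vec using (tabulate)
open import Data.Vec.Base using (toList; allFin)
open import Data.Vec.Properties using (lookup∘tabulate; tabulate∘lookup; tabulate-cong; ≡-dec)
open import Data.List using (List; []; _∷_; _++_; length; filter; cartesianProduct)
open import Data.List.Base using () renaming (map to lmap)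
open import Data.List.Properties using (length-++; filter-++)
open import Data.Product using (Σ; _,_; proj₁; proj₂)
open import Data.Sum using (_⊎_; inj₁; inj₂)
open import Data.Empty using (⊥; ⊥-elim)
open import Data.Bool using (if_then_else_)
open import Relation.Nullary using (¬_; Dec; yes; no; _×-dec_; does)
open import Relation.Unary using (Decidable)
open import Relation.Binary.PropositionalEquality
  using (_≢_; refl; sym; trans; cong; cong₂; subst; subst₂; module ≡-Reasoning)
open import Relation.Binary.Construct.Closure.Transitive using ([_]; _∷_)
open import Relation.Binary using (tri<; tri≈; tri>)
open import Function using (_∘_; id)
open import Algebra.Properties.CommutativeMonoid.Sum +-0-commutativeMonoid
  using (sum; sum-cong-≗; ∑-distrib-+; sum-permute; sum-replicate-zero)

𝟙 : ∀ {a} {A : Set a} → Dec A → ℕ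
𝟙 (yes _) = 1
𝟙 (no _)  = 0

𝟙-yes : ∀ {a} {A : Set a} (d : Dec A) → A → 𝟙 d ≡ 1
𝟙-yes (yes _) _ = refl
𝟙-yes (no ¬x) x = ⊥-elim (¬x x)

𝟙-no : ∀ {a} {A : Set a} (d : Dec A) → ¬ A → 𝟙 d ≡ 0
𝟙-no (yes x) ¬x = ⊥-elim (¬x x)
𝟙-no (no _)  _  = refl

𝟙-cong : ∀ {a b} {A : Set a} {B : Set b} (d : Dec A) (e : Dec B) → (A → B) → (B → A) → 𝟙 d ≡ 𝟙 e
𝟙-cong (yes _) (yes _) _ _ = refl
𝟙-cong (yes x) (no ¬y) f _ = ⊥-elim (¬y (f x))
𝟙-cong (no ¬x) (yes y) _ g = ⊥-elim (¬x (g y))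
𝟙-cong (no _)  (no _)  _ _ = refl

𝟙-mono : ∀ {a b} {A : Set a} {B : Set b} (d : Dec A) (e : Dec B) → (A → B) → 𝟙 d ≤ 𝟙 e
𝟙-mono (yes x) (yes _) _ = ≤-refl
𝟙-mono (yes x) (no ¬y) f = ⊥-elim (¬y (f x))
𝟙-mono (no _)  _       _ = z≤n

sum-mono : ∀ {n} {f g : Fin n → ℕ} → (∀ k → f k ≤ g k) → sum f ≤ sum g
sum-mono {zero}  _  = z≤n
sum-mono {suc n} le = +-mono-≤ (le zero) (sum-mono (le ∘ suc))

sum-bump : ∀ {n} (f g : Fin n → ℕ) (k₀ : Fin n) →
           (∀ k → k ≢ k₀ → f k ≡ g k) → g k₀ ≡ suc (f k₀) → sum g ≡ suc (sum f)
sum-bump f g zero agree bump = begin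
  g zero + sum (g ∘ suc)        ≡⟨ cong₂ _+_ bump (sum-cong-≗ (λ k → sym (agree (suc k) λ ())) ) ⟩
  suc (f zero + sum (f ∘ suc))  ∎
  where open ≡-Reasoning
sum-bump f g (suc k₀) agree bump = begin
  g zero + sum (g ∘ suc)        ≡⟨ cong₂ _+_ (sym (agree zero λ ())) (sum-bump (f ∘ suc) (g ∘ suc) k₀ agree′ bump) ⟩
  f zero + suc (sum (f ∘ suc))  ≡⟨ +-suc (f zero) _ ⟩
  suc (f zero + sum (f ∘ suc))  ∎
  where
  open ≡-Reasoning
  agree′ : ∀ k → k ≢ k₀ → f (suc k) ≡ g (suc k)
  agree′ k k≢k₀ = agree (suc k) (k≢k₀ ∘ Fin-suc-injective)

sum-bump₂ : ∀ {n} (F G : Fin n → Fin n → ℕ) (c d : Fin n) →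
            (∀ i i' → ¬ (i ≡ c × i' ≡ d) → F i i' ≡ G i i') → G c d ≡ suc (F c d) →
            sum (λ i → sum (G i)) ≡ suc (sum (λ i → sum (F i)))
sum-bump₂ F G c d agree bump = sum-bump (λ i → sum (F i)) (λ i → sum (G i)) c
  (λ i i≢c → sum-cong-≗ (λ i' → agree i i' (i≢c ∘ proj₁)))
  (sum-bump (F c) (G c) d (λ i' i'≢d → agree c i' (i'≢d ∘ proj₂)) bump)

sum-reindex : ∀ {n} (σ : Fin n → Fin n) → (∀ k → σ (σ k) ≡ k) → (f : Fin n → ℕ) →
              sum (f ∘ σ) ≡ sum f
sum-reindex σ σσ f = sym (sum-permute f (permutation σ σ σσ σσ))

count-below : ∀ n K → sum {n} (λ k → 𝟙 (toℕ k <? K)) ≡ n ⊓ K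
count-below zero    K       = refl
count-below (suc n) zero    = trans (sum-cong-≗ {suc n} (λ k → 𝟙-no (toℕ k <? 0) λ ())) (sum-replicate-zero (suc n))
count-below (suc n) (suc K) = cong suc (trans (sum-cong-≗ {n} shift) (count-below n K))
  where
  shift : ∀ k → 𝟙 (suc (toℕ k) <? suc K) ≡ 𝟙 (toℕ k <? K)
  shift k = 𝟙-cong (suc (toℕ k) <? suc K) (toℕ k <? K) ℕ.s≤s⁻¹ s≤s

count-point : ∀ {n} (k₀ : Fin n) → sum (λ k → 𝟙 (k ≟ᶠ k₀)) ≡ 1
count-point {n} k₀ = trans (sum-bump (λ _ → 0) (λ k → 𝟙 (k ≟ᶠ k₀)) k₀ (λ k k≢k₀ → sym (𝟙-no _ k≢k₀)) (𝟙-yes _ refl))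
                           (cong suc (sum-replicate-zero n))

length-filter-∷ : ∀ {A : Set} {P : A → Set} (P? : Decidable P) x xs →
                  length (filter P? (x ∷ xs)) ≡ 𝟙 (P? x) + length (filter P? xs)
length-filter-∷ P? x xs with P? x
... | yes _ = refl
... | no _  = refl

length-filter-tabulate : ∀ {A : Set} {P : A → Set} (P? : Decidable P) {n} (f : Fin n → A) →
                         length (filter P? (toList (tabulate f))) ≡ sum (λ k → 𝟙 (P? (f k)))
length-filter-tabulate P? {zero}  f = refl
length-filter-tabulate P? {suc n} f =
  trans (length-filter-∷ P? (f zero) _) (cong (𝟙 (P? (f zero)) +_) (length-filter-tabulate P? (f ∘ suc)))

length-filter-map : ∀ {A B : Set} {P : A → Set} (P? : Decidable P) (g : B → A) (ys : List B) →
                    length (filter P? (lmap g ys)) ≡ length (filter (P? ∘ g) ys)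
length-filter-map P? g []       = refl
length-filter-map P? g (y ∷ ys) = trans (length-filter-∷ P? (g y) _)
  (trans (cong (𝟙 (P? (g y)) +_) (length-filter-map P? g ys)) (sym (length-filter-∷ (P? ∘ g) y ys)))

length-filter-product : ∀ {A B : Set} {P : A × B → Set} (P? : Decidable P) {n} (f : Fin n → A) (ys : List B) →
  length (filter P? (cartesianProduct (toList (tabulate f)) ys)) ≡ sum (λ i → length (filter (λ y → P? (f i , y)) ys))
length-filter-product P? {zero}  f ys = refl
length-filter-product {A} {B} P? {suc n} f ys = begin
  length (filter P? (row ++ rest))              ≡⟨ cong length (filter-++ P? row rest) ⟩
  length (filter P? row ++ filter P? rest)      ≡⟨ length-++ (filter P? row) ⟩
  length (filter P? row) + length (filter P? rest)
    ≡⟨ cong₂ _+_ (length-filter-map P? (f zero ,_) ys) (length-filter-product P? (f ∘ suc) ys) ⟩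
  sum (λ i → length (filter (λ y → P? (f i , y)) ys)) ∎
  where
  open ≡-Reasoning
  row rest : List (A × B)
  row  = lmap (f zero ,_) ys
  rest = cartesianProduct (toList (tabulate (f ∘ suc))) ys

𝟙-inv : ∀ {n} → Perm n → Fin n → Fin n → ℕ
𝟙-inv w i i' = 𝟙 ((i Fin.<? i') ×-dec (app w i' Fin.<? app w i))

ℓ-as-sum : ∀ {n} (w : Perm n) → ℓ w ≡ sum (λ i → sum (𝟙-inv w i))
ℓ-as-sum {n} w = trans (length-filter-product _ {n} id (toList (allFin n)))
                       (sum-cong-≗ {n} (λ i → length-filter-tabulate _ {n} id))

κ-as-sum : ∀ {n} (z : Perm n) → κ z ≡ sum (λ k → 𝟙 (k Fin.<? app z k))
κ-as-sum {n} z = length-filter-tabulate _ {n} id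

app-∘ : ∀ {n} (u v : Perm n) k → app (u ∘ₚ v) k ≡ app u (app v k)
app-∘ u v k = lookup∘tabulate (λ k → app u (app v k)) k

perm-ext : ∀ {n} {u v : Perm n} → (∀ k → app u k ≡ app v k) → u ≡ v
perm-ext {u = u} {v} eq = trans (sym (tabulate∘lookup u)) (trans (tabulate-cong eq) (tabulate∘lookup v))

Injective : ∀ {n} → Perm n → Set
Injective {n} w = ∀ {x y : Fin n} → app w x ≡ app w y → x ≡ y

involution-injective : ∀ {n} (z : Perm n) → IsInvolution z → Injective z
involution-injective z zz {x} {y} eq = trans (sym (zz x)) (trans (cong (app z) eq) (zz y))

∘-injective : ∀ {n} (u v : Perm n) → Injective u → Injective v → Injective (u ∘ₚ v)
∘-injective u v u-inj v-inj {x} {y} eq = v-inj (u-inj (trans (sym (app-∘ u v x)) (trans eq (app-∘ u v y))))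

module Adjacent {n : ℕ} (j : ℕ) (h : suc j < n) where

  a b : Fin n
  a = fromℕ< (<-trans (n<1+n j) h)
  b = fromℕ< h

  σ : Perm n
  σ = s j h

  toℕ-a : toℕ a ≡ j
  toℕ-a = toℕ-fromℕ< (<-trans (n<1+n j) h)

  toℕ-b : toℕ b ≡ suc j
  toℕ-b = toℕ-fromℕ< h

  a≢b : a ≢ b
  a≢b eq = 1+n≢n (sym (trans (sym toℕ-a) (trans (cong toℕ eq) toℕ-b)))

  a<b : a Fin.< b
  a<b rewrite toℕ-a | toℕ-b = n<1+n j

  data Position (k : Fin n) : Set where
    at-a  : k ≡ a → app σ k ≡ b → Position k
    at-b  : k ≡ b → app σ k ≡ a → Position k
    other : k ≢ a → k ≢ b → app σ k ≡ k → Position k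

  position : ∀ k → Position k
  position k with k ≟ᶠ a | k ≟ᶠ b | lookup∘tabulate
    (λ k → if does (k ≟ᶠ a) then b else (if does (k ≟ᶠ b) then a else k)) k
  ... | yes k≡a | _       | σk = at-a k≡a σk
  ... | no k≢a  | yes k≡b | σk = at-b k≡b σk
  ... | no k≢a  | no k≢b  | σk = other k≢a k≢b σk

  σa : app σ a ≡ b
  σa with position a
  ... | at-a _ σa≡b     = σa≡b
  ... | at-b a≡b _      = ⊥-elim (a≢b a≡b)
  ... | other a≢a _ _   = ⊥-elim (a≢a refl)

  σb : app σ b ≡ a
  σb with position b
  ... | at-a b≡a _      = ⊥-elim (a≢b (sym b≡a))
  ... | at-b _ σb≡a     = σb≡a
  ... | other _ b≢b _   = ⊥-elim (b≢b refl)

  σσ : ∀ k → app σ (app σ k) ≡ k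
  σσ k with position k
  ... | at-a k≡a σk = trans (cong (app σ) σk) (trans σb (sym k≡a))
  ... | at-b k≡b σk = trans (cong (app σ) σk) (trans σa (sym k≡b))
  ... | other _ _ σk = trans (cong (app σ) σk) σk

  σ-injective : Injective σ
  σ-injective = involution-injective σ σσ

  σ-monotone : ∀ x y → ¬ (x ≡ a × y ≡ b) → ¬ (x ≡ b × y ≡ a) → x Fin.< y → app σ x Fin.< app σ y
  σ-monotone x y not-ab not-ba x<y with position x | position y
  ... | at-a x≡a _ | at-a y≡a _ = ⊥-elim (<-irrefl (cong toℕ (trans x≡a (sym y≡a))) x<y)
  ... | at-a x≡a _ | at-b y≡b _ = ⊥-elim (not-ab (x≡a , y≡b))
  ... | at-b x≡b _ | at-a y≡a _ = ⊥-elim (not-ba (x≡b , y≡a))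
  ... | at-b x≡b _ | at-b y≡b _ = ⊥-elim (<-irrefl (cong toℕ (trans x≡b (sym y≡b))) x<y)
  ... | other _ _ σx | other _ _ σy rewrite σx | σy = x<y
  ... | at-a x≡a σx | other _ y≢b σy rewrite σx | σy | x≡a | toℕ-a | toℕ-b =
    ≤∧≢⇒< x<y (λ j+1≡y → y≢b (toℕ-injective (trans (sym j+1≡y) (sym toℕ-b))))
  ... | at-b x≡b σx | other _ _ σy rewrite σx | σy | x≡b | toℕ-a | toℕ-b = <-trans (n<1+n j) x<y
  ... | other _ _ σx | at-a y≡a σy rewrite σx | σy | y≡a | toℕ-a | toℕ-b = <-trans x<y (n<1+n j)
  ... | other x≢a _ σx | at-b y≡b σy rewrite σx | σy | y≡b | toℕ-a | toℕ-b =
    ≤∧≢⇒< (ℕ.s≤s⁻¹ x<y) (λ x≡j → x≢a (toℕ-injective (trans x≡j (sym toℕ-a))))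

  σ-reflects-< : ∀ x y → ¬ (x ≡ a × y ≡ b) → ¬ (x ≡ b × y ≡ a) → app σ x Fin.< app σ y → x Fin.< y
  σ-reflects-< x y not-ab not-ba σx<σy = subst₂ Fin._<_ (σσ x) (σσ y)
    (σ-monotone (app σ x) (app σ y) (λ (σx≡a , σy≡b) → not-ba (σ⁻¹a σx≡a , σ⁻¹b σy≡b))
                                     (λ (σx≡b , σy≡a) → not-ab (σ⁻¹b σx≡b , σ⁻¹a σy≡a)) σx<σy)
    where
    σ⁻¹a : ∀ {k} → app σ k ≡ a → k ≡ b
    σ⁻¹a {k} σk≡a = trans (sym (σσ k)) (trans (cong (app σ) σk≡a) σa)
    σ⁻¹b : ∀ {k} → app σ k ≡ b → k ≡ a
    σ⁻¹b {k} σk≡b = trans (sym (σσ k)) (trans (cong (app σ) σk≡b) σb)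

  σa>σb : app σ b Fin.< app σ a
  σa>σb = subst₂ Fin._<_ (sym σb) (sym σa) a<b

  -- Right multiplication by σ at an ascent (w(a) < w(b)) creates exactly one
  -- new inversion: reindexing by σ, only the pair (b , a) changes status.
  ℓ-right-ascent : (w : Perm n) → app w a Fin.< app w b → ℓ (w ∘ₚ σ) ≡ suc (ℓ w)
  ℓ-right-ascent w asc = begin
    ℓ (w ∘ₚ σ)                                       ≡⟨ ℓ-as-sum (w ∘ₚ σ) ⟩
    sum (λ i → sum (𝟙-inv (w ∘ₚ σ) i))                ≡⟨ sum-cong-≗ {n} (λ i → sum-cong-≗ {n} (unfold i)) ⟩
    sum (λ i → sum (λ i' → H (app σ i) (app σ i')))  ≡⟨ sum-cong-≗ {n} (λ i → sum-reindex (app σ) σσ (H (app σ i))) ⟩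
    sum (λ i → sum (H (app σ i)))                    ≡⟨ sum-reindex (app σ) σσ (λ x → sum (H x)) ⟩
    sum (λ i → sum (H i))                            ≡⟨ sum-bump₂ (𝟙-inv w) H b a agree bump ⟩
    suc (sum (λ i → sum (𝟙-inv w i)))                 ≡⟨ cong suc (ℓ-as-sum w) ⟨
    suc (ℓ w)                                        ∎
    where
    open ≡-Reasoning
    H : Fin n → Fin n → ℕ
    H x y = 𝟙 ((app σ x Fin.<? app σ y) ×-dec (app w y Fin.<? app w x))
    unfold : ∀ i i' → 𝟙-inv (w ∘ₚ σ) i i' ≡ H (app σ i) (app σ i')
    unfold i i' rewrite app-∘ w σ i | app-∘ w σ i' = 𝟙-cong _ _
      (λ (i<i' , inv) → subst₂ Fin._<_ (sym (σσ i)) (sym (σσ i')) i<i' , inv)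
      (λ (i<i' , inv) → subst₂ Fin._<_ (σσ i) (σσ i') i<i' , inv)
    agree : ∀ x y → ¬ (x ≡ b × y ≡ a) → 𝟙-inv w x y ≡ H x y
    agree x y not-ba with x ≟ᶠ a | y ≟ᶠ b
    ... | yes refl | yes refl = trans (𝟙-no _ (λ (_ , dsc) → <-asym dsc asc)) (sym (𝟙-no _ (λ (σa<σb , _) → <-asym σa<σb σa>σb)))
    ... | no x≢a | _ = 𝟙-cong _ _
      (λ (x<y , inv) → σ-monotone x y (x≢a ∘ proj₁) not-ba x<y , inv)
      (λ (σx<σy , inv) → σ-reflects-< x y (x≢a ∘ proj₁) not-ba σx<σy , inv)
    ... | yes _ | no y≢b = 𝟙-cong _ _
      (λ (x<y , inv) → σ-monotone x y (y≢b ∘ proj₂) not-ba x<y , inv)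
      (λ (σx<σy , inv) → σ-reflects-< x y (y≢b ∘ proj₂) not-ba σx<σy , inv)
    bump : H b a ≡ suc (𝟙-inv w b a)
    bump = trans (𝟙-yes _ (σa>σb , asc)) (cong suc (sym (𝟙-no _ (λ (b<a , _) → <-asym b<a a<b))))

  ℓ-left-ascent : (u : Perm n) → Injective u → (c d : Fin n) → app u c ≡ a → app u d ≡ b → c Fin.< d →
                  ℓ (σ ∘ₚ u) ≡ suc (ℓ u)
  ℓ-left-ascent u u-inj c d uc ud c<d = begin
    ℓ (σ ∘ₚ u)                            ≡⟨ ℓ-as-sum (σ ∘ₚ u) ⟩
    sum (λ i → sum (𝟙-inv (σ ∘ₚ u) i))     ≡⟨ sum-bump₂ (𝟙-inv u) (𝟙-inv (σ ∘ₚ u)) c d agree bump ⟩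
    suc (sum (λ i → sum (𝟙-inv u i)))      ≡⟨ cong suc (ℓ-as-sum u) ⟨
    suc (ℓ u)                             ∎
    where
    open ≡-Reasoning
    agree : ∀ i i' → ¬ (i ≡ c × i' ≡ d) → 𝟙-inv u i i' ≡ 𝟙-inv (σ ∘ₚ u) i i'
    agree i i' not-cd rewrite app-∘ σ u i | app-∘ σ u i' = 𝟙-cong _ _
      (λ (i<i' , inv) → i<i' , σ-monotone (app u i') (app u i) (not-ab i<i') (not-ba i<i') inv)
      (λ (i<i' , inv) → i<i' , σ-reflects-< (app u i') (app u i) (not-ab i<i') (not-ba i<i') inv)
      where
      not-ab : i Fin.< i' → ¬ (app u i' ≡ a × app u i ≡ b)
      not-ab i<i' (ui'≡a , ui≡b) =
        <-asym c<d (subst₂ Fin._<_ (u-inj (trans ui≡b (sym ud))) (u-inj (trans ui'≡a (sym uc))) i<i')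
      not-ba : i Fin.< i' → ¬ (app u i' ≡ b × app u i ≡ a)
      not-ba _ (ui'≡b , ui≡a) = not-cd (u-inj (trans ui≡a (sym uc)) , u-inj (trans ui'≡b (sym ud)))
    bump : 𝟙-inv (σ ∘ₚ u) c d ≡ suc (𝟙-inv u c d)
    bump rewrite app-∘ σ u c | app-∘ σ u d | uc | ud =
      trans (𝟙-yes _ (c<d , σa>σb)) (cong suc (sym (𝟙-no _ (λ (_ , b<a) → <-asym b<a a<b))))

  -- Conjugating an involution x by σ preserves the number of 2-cycles, as
  -- long as (a b) is not itself a 2-cycle of x: σ then preserves the order of
  -- every pair (k , x(k)), and we reindex the count by σ.
  κ-conjugate : (x : Perm n) → IsInvolution x → app x a ≢ b → κ (σ ∘ₚ (x ∘ₚ σ)) ≡ κ x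
  κ-conjugate x xx xa≢b = begin
    κ (σ ∘ₚ (x ∘ₚ σ))                        ≡⟨ κ-as-sum (σ ∘ₚ (x ∘ₚ σ)) ⟩
    sum (λ k → 𝟙 (k Fin.<? app (σ ∘ₚ (x ∘ₚ σ)) k)) ≡⟨ sum-cong-≗ {n} unfold ⟩
    sum (f ∘ app σ)                          ≡⟨ sum-reindex (app σ) σσ f ⟩
    sum f                                    ≡⟨ sum-cong-≗ {n} untwist ⟩
    sum (λ k → 𝟙 (k Fin.<? app x k))         ≡⟨ κ-as-sum x ⟨
    κ x                                      ∎
    where
    open ≡-Reasoning
    f : Fin n → ℕ
    f k = 𝟙 (app σ k Fin.<? app σ (app x k))
    unfold : ∀ k → 𝟙 (k Fin.<? app (σ ∘ₚ (x ∘ₚ σ)) k) ≡ f (app σ k)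
    unfold k rewrite app-∘ σ (x ∘ₚ σ) k | app-∘ x σ k = 𝟙-cong _ _
      (subst (Fin._< app σ (app x (app σ k))) (sym (σσ k)))
      (subst (Fin._< app σ (app x (app σ k))) (σσ k))
    not-ab : ∀ k → ¬ (k ≡ a × app x k ≡ b)
    not-ab k (refl , xa≡b) = xa≢b xa≡b
    not-ba : ∀ k → ¬ (k ≡ b × app x k ≡ a)
    not-ba k (refl , xb≡a) = xa≢b (trans (cong (app x) (sym xb≡a)) (xx b))
    untwist : ∀ k → f k ≡ 𝟙 (k Fin.<? app x k)
    untwist k = 𝟙-cong _ _ (σ-reflects-< k (app x k) (not-ab k) (not-ba k))
                           (σ-monotone k (app x k) (not-ab k) (not-ba k))

  κ-join : (x : Perm n) → app x a ≡ a → app x b ≡ b → κ (x ∘ₚ σ) ≡ suc (κ x)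
  κ-join x xa xb = begin
    κ (x ∘ₚ σ)                                ≡⟨ κ-as-sum (x ∘ₚ σ) ⟩
    sum (λ k → 𝟙 (k Fin.<? app (x ∘ₚ σ) k))   ≡⟨ sum-bump _ _ a agree bump ⟩
    suc (sum (λ k → 𝟙 (k Fin.<? app x k)))    ≡⟨ cong suc (κ-as-sum x) ⟨
    suc (κ x)                                 ∎
    where
    open ≡-Reasoning
    agree : ∀ k → k ≢ a → 𝟙 (k Fin.<? app x k) ≡ 𝟙 (k Fin.<? app (x ∘ₚ σ) k)
    agree k k≢a rewrite app-∘ x σ k with position k
    ... | at-a k≡a _ = ⊥-elim (k≢a k≡a)
    ... | at-b refl σb≡a rewrite σb≡a | xa | xb =
      trans (𝟙-no _ (<-irrefl refl)) (sym (𝟙-no _ (λ b<a → <-asym b<a a<b)))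
    ... | other _ _ σk rewrite σk = refl
    bump : 𝟙 (a Fin.<? app (x ∘ₚ σ) a) ≡ suc (𝟙 (a Fin.<? app x a))
    bump rewrite app-∘ x σ a | σa | xa | xb = trans (𝟙-yes _ a<b) (cong suc (sym (𝟙-no _ (<-irrefl refl))))

  Commutes : Perm n → Set
  Commutes z = σ ∘ₚ z ≡ z ∘ₚ σ

  commutes? : ∀ z → Dec (Commutes z)
  commutes? z = ≡-dec _≟ᶠ_ (σ ∘ₚ z) (z ∘ₚ σ)

  ∗-commuting : ∀ z → Commutes z → (z ∗s j) h ≡ z ∘ₚ σ
  ∗-commuting z c with commutes? z
  ... | yes _ = refl
  ... | no ¬c = ⊥-elim (¬c c)

  ∗-noncommuting : ∀ z → ¬ Commutes z → (z ∗s j) h ≡ σ ∘ₚ (z ∘ₚ σ)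
  ∗-noncommuting z ¬c with commutes? z
  ... | yes c = ⊥-elim (¬c c)
  ... | no _  = refl

  commutes-at : ∀ z → Commutes z → ∀ k → app σ (app z k) ≡ app z (app σ k)
  commutes-at z c k = trans (sym (app-∘ σ z k)) (trans (cong (λ v → app v k) c) (app-∘ z σ k))

  commutes-from : ∀ z → (∀ k → app σ (app z k) ≡ app z (app σ k)) → Commutes z
  commutes-from z eq = perm-ext (λ k → trans (app-∘ σ z k) (trans (eq k) (sym (app-∘ z σ k))))

  app-conj : ∀ z k → app (σ ∘ₚ (z ∘ₚ σ)) k ≡ app σ (app z (app σ k))
  app-conj z k = trans (app-∘ σ (z ∘ₚ σ) k) (cong (app σ) (app-∘ z σ k))

  Stabilises : Perm n → Set
  Stabilises z = (app z a ≡ a × app z b ≡ b) ⊎ (app z a ≡ b × app z b ≡ a)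

  commutes-b : ∀ z → Commutes z → app z b ≡ app σ (app z a)
  commutes-b z c = trans (cong (app z) (sym σa)) (sym (commutes-at z c a))

  commutes⇒stabilises : ∀ z → IsInvolution z → Commutes z → Stabilises z
  commutes⇒stabilises z zz c with position (app z a)
  ... | at-a za≡a _ = inj₁ (za≡a , trans (commutes-b z c) (trans (cong (app σ) za≡a) σa))
  ... | at-b za≡b _ = inj₂ (za≡b , trans (commutes-b z c) (trans (cong (app σ) za≡b) σb))
  ... | other _ _ σza≡za = ⊥-elim (a≢b (involution-injective z zz
          (trans (sym σza≡za) (trans (commutes-at z c a) (cong (app z) σa)))))

  stabilises⇒commutes : ∀ z → IsInvolution z → Stabilises z → Commutes z
  stabilises⇒commutes z zz st = commutes-from z (λ k → pointwise k st)
    where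
    -- z maps {a, b} onto itself, hence also its complement
    outside : ∀ k → k ≢ a → k ≢ b → Stabilises z → app σ (app z k) ≡ app z k
    outside k k≢a k≢b st with position (app z k) | st
    ... | other _ _ σzk | _ = σzk
    ... | at-a zk≡a _ | inj₁ (za , _) = ⊥-elim (k≢a (trans (sym (zz k)) (trans (cong (app z) zk≡a) za)))
    ... | at-a zk≡a _ | inj₂ (za , _) = ⊥-elim (k≢b (trans (sym (zz k)) (trans (cong (app z) zk≡a) za)))
    ... | at-b zk≡b _ | inj₁ (_ , zb) = ⊥-elim (k≢b (trans (sym (zz k)) (trans (cong (app z) zk≡b) zb)))
    ... | at-b zk≡b _ | inj₂ (_ , zb) = ⊥-elim (k≢a (trans (sym (zz k)) (trans (cong (app z) zk≡b) zb)))
    pointwise : ∀ k → Stabilises z → app σ (app z k) ≡ app z (app σ k)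
    pointwise k st with position k | st
    ... | other k≢a k≢b σk | _ rewrite σk = outside k k≢a k≢b st
    ... | at-a refl σk | inj₁ (za , zb) rewrite σk | za | zb = σa
    ... | at-a refl σk | inj₂ (za , zb) rewrite σk | za | zb = σb
    ... | at-b refl σk | inj₁ (za , zb) rewrite σk | za | zb = σb
    ... | at-b refl σk | inj₂ (za , zb) rewrite σk | za | zb = σa

  conj-conj : ∀ z → σ ∘ₚ ((σ ∘ₚ (z ∘ₚ σ)) ∘ₚ σ) ≡ z
  conj-conj z = perm-ext λ k → begin
    app (σ ∘ₚ ((σ ∘ₚ (z ∘ₚ σ)) ∘ₚ σ)) k       ≡⟨ app-conj (σ ∘ₚ (z ∘ₚ σ)) k ⟩
    app σ (app (σ ∘ₚ (z ∘ₚ σ)) (app σ k))     ≡⟨ cong (app σ) (app-conj z (app σ k)) ⟩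
    app σ (app σ (app z (app σ (app σ k))))   ≡⟨ σσ _ ⟩
    app z (app σ (app σ k))                   ≡⟨ cong (app z) (σσ k) ⟩
    app z k                                   ∎
    where open ≡-Reasoning

  conj-fixed⇒commutes : ∀ z → σ ∘ₚ (z ∘ₚ σ) ≡ z → Commutes z
  conj-fixed⇒commutes z fixed = commutes-from z λ k → begin
    app σ (app z k)                            ≡⟨ cong (λ t → app σ (app z t)) (sym (σσ k)) ⟩
    app σ (app z (app σ (app σ k)))            ≡⟨ app-conj z (app σ k) ⟨
    app (σ ∘ₚ (z ∘ₚ σ)) (app σ k)              ≡⟨ cong (λ v → app v (app σ k)) fixed ⟩
    app z (app σ k)                            ∎
    where open ≡-Reasoning

  commutes⇒conj-fixed : ∀ z → Commutes z → σ ∘ₚ (z ∘ₚ σ) ≡ z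
  commutes⇒conj-fixed z c = perm-ext λ k → begin
    app (σ ∘ₚ (z ∘ₚ σ)) k          ≡⟨ app-conj z k ⟩
    app σ (app z (app σ k))        ≡⟨ commutes-at z c (app σ k) ⟩
    app z (app σ (app σ k))        ≡⟨ cong (app z) (σσ k) ⟩
    app z k                        ∎
    where open ≡-Reasoning

  ∗-involution : ∀ z → IsInvolution z → IsInvolution ((z ∗s j) h) × (((z ∗s j) h ∗s j) h ≡ z)
  ∗-involution z zz with commutes? z
  ... | yes c = zσ-involution , trans (∗-commuting (z ∘ₚ σ) zσ-commutes) (perm-ext undo)
    where
    zσ-involution : IsInvolution (z ∘ₚ σ)
    zσ-involution k = begin
      app (z ∘ₚ σ) (app (z ∘ₚ σ) k)        ≡⟨ app-∘ z σ _ ⟩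
      app z (app σ (app (z ∘ₚ σ) k))       ≡⟨ cong (λ t → app z (app σ t)) (app-∘ z σ k) ⟩
      app z (app σ (app z (app σ k)))      ≡⟨ cong (app z) (commutes-at z c (app σ k)) ⟩
      app z (app z (app σ (app σ k)))      ≡⟨ zz _ ⟩
      app σ (app σ k)                      ≡⟨ σσ k ⟩
      k                                    ∎
      where open ≡-Reasoning
    zσ-commutes : Commutes (z ∘ₚ σ)
    zσ-commutes = commutes-from (z ∘ₚ σ) λ k →
      trans (cong (app σ) (app-∘ z σ k)) (trans (commutes-at z c (app σ k)) (sym (app-∘ z σ (app σ k))))
    undo : ∀ k → app ((z ∘ₚ σ) ∘ₚ σ) k ≡ app z k
    undo k = trans (app-∘ (z ∘ₚ σ) σ k) (trans (app-∘ z σ _) (cong (app z) (σσ k)))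
  ... | no ¬c = σzσ-involution , trans (∗-noncommuting _ σzσ-noncommuting) (conj-conj z)
    where
    σzσ-involution : IsInvolution (σ ∘ₚ (z ∘ₚ σ))
    σzσ-involution k = begin
      app (σ ∘ₚ (z ∘ₚ σ)) (app (σ ∘ₚ (z ∘ₚ σ)) k)       ≡⟨ app-conj z _ ⟩
      app σ (app z (app σ (app (σ ∘ₚ (z ∘ₚ σ)) k)))     ≡⟨ cong (λ t → app σ (app z (app σ t))) (app-conj z k) ⟩
      app σ (app z (app σ (app σ (app z (app σ k)))))   ≡⟨ cong (λ t → app σ (app z t)) (σσ _) ⟩
      app σ (app z (app z (app σ k)))                   ≡⟨ cong (app σ) (zz _) ⟩
      app σ (app σ k)                                   ≡⟨ σσ k ⟩
      k                                                 ∎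
      where open ≡-Reasoning
    σzσ-noncommuting : ¬ Commutes (σ ∘ₚ (z ∘ₚ σ))
    σzσ-noncommuting c = ¬c (conj-fixed⇒commutes z
      (trans (sym (commutes⇒conj-fixed (σ ∘ₚ (z ∘ₚ σ)) c)) (conj-conj z)))

  noncommuting-not-ab : ∀ z → IsInvolution z → ¬ Commutes z → ¬ (app z a ≡ a × app z b ≡ b)
  noncommuting-not-ab z zz ¬c fixed = ¬c (stabilises⇒commutes z zz (inj₁ fixed))

  noncommuting-not-ba : ∀ z → IsInvolution z → ¬ Commutes z → ¬ (app z a ≡ b × app z b ≡ a)
  noncommuting-not-ba z zz ¬c swapped = ¬c (stabilises⇒commutes z zz (inj₂ swapped))

  noncommuting-no-swap : ∀ z → IsInvolution z → ¬ Commutes z → app z a ≢ b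
  noncommuting-no-swap z zz ¬c za≡b =
    noncommuting-not-ba z zz ¬c (za≡b , trans (cong (app z) (sym za≡b)) (zz a))

  -- Conjugating a noncommuting involution at an ascent creates two inversions:
  -- one from right multiplication, one from left multiplication by σ.
  ℓ-conjugate-ascent : ∀ z → IsInvolution z → ¬ Commutes z → app z a Fin.< app z b →
                       ℓ (σ ∘ₚ (z ∘ₚ σ)) ≡ suc (suc (ℓ z))
  ℓ-conjugate-ascent z zz ¬c asc = begin
    ℓ (σ ∘ₚ (z ∘ₚ σ))      ≡⟨ ℓ-left-ascent (z ∘ₚ σ) zσ-injective c d zσc zσd c<d ⟩
    suc (ℓ (z ∘ₚ σ))       ≡⟨ cong suc (ℓ-right-ascent z asc) ⟩
    suc (suc (ℓ z))        ∎
    where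
    open ≡-Reasoning
    c d : Fin n
    c = app σ (app z a)
    d = app σ (app z b)
    zσ-injective : Injective (z ∘ₚ σ)
    zσ-injective = ∘-injective z σ (involution-injective z zz) σ-injective
    zσc : app (z ∘ₚ σ) c ≡ a
    zσc = trans (app-∘ z σ c) (trans (cong (app z) (σσ _)) (zz a))
    zσd : app (z ∘ₚ σ) d ≡ b
    zσd = trans (app-∘ z σ d) (trans (cong (app z) (σσ _)) (zz b))
    c<d : c Fin.< d
    c<d = σ-monotone (app z a) (app z b) (noncommuting-not-ab z zz ¬c) (noncommuting-not-ba z zz ¬c) asc

  GoesUp : Perm n → Perm n → Set
  GoesUp z y = ℓ z < ℓ y × ((app z a ≡ a × app z b ≡ b × κ y ≡ suc (κ z)) ⊎ κ y ≡ κ z)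

  ascent-step : ∀ z → IsInvolution z → app z a Fin.< app z b → GoesUp z ((z ∗s j) h)
  ascent-step z zz asc = by-cases (commutes? z)
    where
    by-cases : Dec (Commutes z) → GoesUp z ((z ∗s j) h)
    by-cases (no ¬c) = subst (GoesUp z) (sym (∗-noncommuting z ¬c))
      ( subst (ℓ z <_) (sym (ℓ-conjugate-ascent z zz ¬c asc)) (<-trans (n<1+n _) (n<1+n _))
      , inj₂ (κ-conjugate z zz (noncommuting-no-swap z zz ¬c)))
    by-cases (yes c) with commutes⇒stabilises z zz c
    ... | inj₁ (za , zb) = subst (GoesUp z) (sym (∗-commuting z c))
      (subst (ℓ z <_) (sym (ℓ-right-ascent z asc)) (n<1+n _) , inj₁ (za , zb , κ-join z za zb))
    ... | inj₂ (za , zb) = ⊥-elim (<-asym asc (subst₂ Fin._<_ (sym zb) (sym za) a<b))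

  GoesDown : Perm n → Perm n → Set
  GoesDown x y = (app y a ≡ a × app y b ≡ b × κ x ≡ suc (κ y))
               ⊎ (κ y ≡ κ x × app y a Fin.< app y b × ¬ (app y a ≡ a × app y b ≡ b))

  not-longer : (x y : Perm n) (k : ℕ) → ℓ y < ℓ x → ℓ y ≡ k + ℓ x → ⊥
  not-longer x y k shorter eq = <-irrefl refl (≤-trans shorter (subst (ℓ x ≤_) (sym eq) (m≤n+m (ℓ x) k)))

  -- Commuting case, y = x σ: x cannot fix a and b (that would lengthen it), so
  -- x swaps them and y splits the 2-cycle (a b).
  commuting-descent : ∀ x y → y ≡ x ∘ₚ σ → Stabilises x → ℓ y < ℓ x → GoesDown x y
  commuting-descent x y y≡xσ (inj₁ (xa , xb)) shorter = ⊥-elim (not-longer x y 1 shorter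
    (trans (cong ℓ y≡xσ) (ℓ-right-ascent x (subst₂ Fin._<_ (sym xa) (sym xb) a<b))))
  commuting-descent x y y≡xσ (inj₂ (xa , xb)) _ = inj₁ (ya , yb , trans (cong κ x≡yσ) (κ-join y ya yb))
    where
    ya : app y a ≡ a
    ya = trans (cong (λ v → app v a) y≡xσ) (trans (app-∘ x σ a) (trans (cong (app x) σa) xb))
    yb : app y b ≡ b
    yb = trans (cong (λ v → app v b) y≡xσ) (trans (app-∘ x σ b) (trans (cong (app x) σb) xa))
    x≡yσ : x ≡ y ∘ₚ σ
    x≡yσ = perm-ext λ k → sym (trans (app-∘ y σ k)
      (trans (cong (λ v → app v (app σ k)) y≡xσ) (trans (app-∘ x σ _) (cong (app x) (σσ k)))))

  noncommuting-descent : ∀ x y → IsInvolution x → ¬ Commutes x → y ≡ σ ∘ₚ (x ∘ₚ σ) →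
                         app x b Fin.< app x a → GoesDown x y
  noncommuting-descent x y xx ¬c y≡σxσ dsc =
    inj₂ (trans (cong κ y≡σxσ) (κ-conjugate x xx (noncommuting-no-swap x xx ¬c)) , asc , not-fixed)
    where
    ya : app y a ≡ app σ (app x b)
    ya = trans (cong (λ v → app v a) y≡σxσ) (trans (app-conj x a) (cong (λ t → app σ (app x t)) σa))
    yb : app y b ≡ app σ (app x a)
    yb = trans (cong (λ v → app v b) y≡σxσ) (trans (app-conj x b) (cong (λ t → app σ (app x t)) σb))
    asc : app y a Fin.< app y b
    asc = subst₂ Fin._<_ (sym ya) (sym yb) (σ-monotone (app x b) (app x a)
      (λ (xb≡a , xa≡b) → noncommuting-not-ba x xx ¬c (xa≡b , xb≡a))
      (λ (xb≡b , xa≡a) → noncommuting-not-ab x xx ¬c (xa≡a , xb≡b)) dsc)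
    not-fixed : ¬ (app y a ≡ a × app y b ≡ b)
    not-fixed (ya≡a , yb≡b) = noncommuting-not-ab x xx ¬c
      ( trans (sym (σσ _)) (trans (cong (app σ) (trans (sym yb) yb≡b)) σb)
      , trans (sym (σσ _)) (trans (cong (app σ) (trans (sym ya) ya≡a)) σa))

  descent-step : ∀ x y → IsInvolution x → y ≡ (x ∗s j) h → ℓ y < ℓ x → GoesDown x y
  descent-step x y xx y≡x∗s shorter = by-cases (commutes? x)
    where
    by-cases : Dec (Commutes x) → GoesDown x y
    by-cases (yes c) = commuting-descent x y (trans y≡x∗s (∗-commuting x c)) (commutes⇒stabilises x xx c) shorter
    by-cases (no ¬c) with <-cmp (toℕ (app x a)) (toℕ (app x b))
    ... | tri< asc _ _ = ⊥-elim (not-longer x y 2 shorter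
            (trans (cong ℓ (trans y≡x∗s (∗-noncommuting x ¬c))) (ℓ-conjugate-ascent x xx ¬c asc)))
    ... | tri≈ _ xa≡xb _ = ⊥-elim (a≢b (involution-injective x xx (toℕ-injective xa≡xb)))
    ... | tri> _ _ dsc = noncommuting-descent x y xx ¬c (trans y≡x∗s (∗-noncommuting x ¬c)) dsc

Mirror : ℕ → ℕ → ℕ → Set
Mirror n t u = suc (t + u) ≡ n

mirror-of : ∀ {n t} → t < n → Mirror n (n ∸ suc t) t
mirror-of {n} {t} t<n = trans (sym (+-suc (n ∸ suc t) t)) (m∸n+n≡m t<n)

mirror-sym : ∀ {n t u} → Mirror n t u → Mirror n u t
mirror-sym {t = t} {u} eq = trans (cong suc (+-comm u t)) eq

mirror-unique : ∀ {n t u u'} → Mirror n t u → Mirror n t u' → u ≡ u'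
mirror-unique {t = t} eq eq' = +-cancelˡ-≡ t _ _ (suc-injective (trans eq (sym eq')))

mirror-≡ : ∀ {n t u} → Mirror n t u → u ≡ n ∸ suc t
mirror-≡ {n} {t} {u} eq = sym (trans (cong (_∸ suc t) (sym eq)) (m+n∸m≡n t u))

mirror-< : ∀ {n t u} → Mirror n t u → t < n
mirror-< {t = t} {u} eq = subst (t <_) eq (s≤s (m≤m+n t u))

mirror-small : ∀ {n t u k} → Mirror n t u → n ≤ u + k → t < k
mirror-small {n} {t} {u} {k} eq n≤u+k = +-cancelʳ-≤ u (suc t) k (begin
  suc t + u  ≡⟨ eq ⟩
  n          ≤⟨ n≤u+k ⟩
  u + k      ≡⟨ +-comm u k ⟩
  k + u      ∎)
  where open ≤-Reasoning

mirror-large : ∀ {n t u k} → Mirror n t u → t < k → n ≤ u + k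
mirror-large {n} {t} {u} {k} eq t<k = begin
  n          ≡⟨ eq ⟨
  suc t + u  ≤⟨ +-monoˡ-≤ u t<k ⟩
  k + u      ≡⟨ +-comm k u ⟩
  u + k      ∎
  where open ≤-Reasoning

mirror-antitone : ∀ {n t u t' u'} → Mirror n t u → Mirror n t' u' → t < t' → u' < u
mirror-antitone {n} {t} {u} {t'} {u'} eq eq' t<t' = +-cancelˡ-< t' u' u (begin-strict
  t' + u'  ≡⟨ suc-injective (trans eq' (sym eq)) ⟩
  t + u    <⟨ +-monoˡ-< u t<t' ⟩
  t' + u   ∎)
  where open ≤-Reasoning

mirror-below-half : ∀ {n t u} → Mirror n t u → suc t + suc t ≤ n → t < u
mirror-below-half {n} {t} {u} eq 2t+2≤n = +-cancelˡ-≤ (suc t) (suc t) u (begin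
  suc t + suc t  ≤⟨ 2t+2≤n ⟩
  n              ≡⟨ eq ⟨
  suc t + u      ∎)
  where open ≤-Reasoning

module Rigidity (n m : ℕ) (m+m≤n : m + m ≤ n) (Z : ℕ → ℕ) (K : ℕ)
  (Z-bounded : ∀ k → k < n → Z k < n)
  (Z-involution : ∀ k → k < n → Z (Z k) ≡ k)
  (ascent-fixed : ∀ j → suc j < n → Z j < Z (suc j) → Z j ≡ j × Z (suc j) ≡ suc j × m ≤ K)
  (K≤m : K ≤ m)
  (K-upper : ∀ k → (∀ t → t < n → t < Z t → t < k) → K ≤ k)
  (K-lower : ∀ k t → k ≤ t → t < n → (∀ u → u < k → u < Z u) → t < Z t → suc k ≤ K)
  where

  Reversed : ℕ → Set
  Reversed t = Mirror n t (Z t)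

  Outer : ℕ → Set
  Outer k = ∀ t → t < k → Reversed t

  Inner : ℕ → ℕ → Set
  Inner k x = k ≤ x × x + k < n

  inner-< : ∀ {k x} → Inner k x → x < n
  inner-< {k} {x} (_ , x+k<n) = ≤-<-trans (m≤m+n x k) x+k<n

  inner-≤-top : ∀ {k x} → Inner k x → x ≤ n ∸ suc k
  inner-≤-top {k} {x} (k≤x , x+k<n) = +-cancelʳ-≤ k x (n ∸ suc k)
    (ℕ.s≤s⁻¹ (subst (suc (x + k) ≤_) (sym (mirror-of (≤-<-trans k≤x (inner-< (k≤x , x+k<n))))) x+k<n))

  outer-partner : ∀ {k t' t} → Outer k → t' < k → Mirror n t' t → Z t ≡ t'
  outer-partner o t'<k mir = trans (cong Z (sym (mirror-unique (o _ t'<k) mir))) (Z-involution _ (mirror-< mir))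

  inner-closed : ∀ {k x} → Outer k → Inner k x → Inner k (Z x)
  inner-closed {k} {x} o (k≤x , x+k<n) = lower , upper
    where
    x<n : x < n
    x<n = inner-< (k≤x , x+k<n)
    lower : k ≤ Z x
    lower with k ≤? Z x
    ... | yes k≤Zx = k≤Zx
    ... | no k≰Zx = ⊥-elim (<⇒≱ x+k<n (mirror-large (subst (Mirror n (Z x)) (Z-involution x x<n) (o (Z x) Zx<k)) Zx<k))
      where
      Zx<k : Z x < k
      Zx<k = ≰⇒> k≰Zx
    upper : Z x + k < n
    upper with Z x + k <? n
    ... | yes Zx+k<n = Zx+k<n
    ... | no Zx+k≮n = ⊥-elim (<⇒≱ (subst (_< k) (sym x≡t) t<k) k≤x)
      where
      mir : Mirror n (n ∸ suc (Z x)) (Z x)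
      mir = mirror-of (Z-bounded x x<n)
      t<k : n ∸ suc (Z x) < k
      t<k = mirror-small mir (≮⇒≥ Zx+k≮n)
      x≡t : x ≡ n ∸ suc (Z x)
      x≡t = trans (sym (Z-involution x x<n)) (outer-partner o t<k mir)

  openers-outer : ∀ {k} → Outer k → (∀ x → Inner k x → Z x ≡ x) → ∀ t → t < n → t < Z t → t < k
  openers-outer {k} o fixed t t<n t<Zt with t <? k | t + k <? n
  ... | yes t<k | _ = t<k
  ... | no t≮k | yes t+k<n = ⊥-elim (<-irrefl (sym (fixed t (≮⇒≥ t≮k , t+k<n))) t<Zt)
  ... | no t≮k | no t+k≮n = ⊥-elim (<-asym t<Zt (subst (_< t) (sym Zt≡t') (<-≤-trans t'<k (≮⇒≥ t≮k))))
    where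
    mir : Mirror n (n ∸ suc t) t
    mir = mirror-of t<n
    t'<k : n ∸ suc t < k
    t'<k = mirror-small mir (≮⇒≥ t+k≮n)
    Zt≡t' : Z t ≡ n ∸ suc t
    Zt≡t' = outer-partner o t'<k mir

  inner-if-≤-top : ∀ {k x} → k < n → k ≤ x → x ≤ n ∸ suc k → Inner k x
  inner-if-≤-top {k} {x} k<n k≤x x≤top = k≤x , (begin-strict
    x + k            ≤⟨ +-monoˡ-≤ k x≤top ⟩
    n ∸ suc k + k    <⟨ n<1+n _ ⟩
    suc (n ∸ suc k + k) ≡⟨ mirror-of k<n ⟩
    n                ∎)
    where open ≤-Reasoning

  -- Descending from a fixed top position n-1-k, Inner k is fixed pointwise:
  -- if x+1 is fixed then either Z x < x+1 = Z(x+1) is an ascent, whose points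
  -- are fixed, or Z x > x lies higher in Inner k and is fixed, so x = Z x.
  inner-fixed : ∀ {k} → Outer k → Z (n ∸ suc k) ≡ n ∸ suc k → ∀ x → Inner k x → Z x ≡ x
  inner-fixed {k} o top-fixed x x-inner = fixed-within (n ∸ suc k) x x-inner (m≤n+m _ x)
    where
    top : ℕ
    top = n ∸ suc k
    fixed-within : ∀ d x → Inner k x → top ≤ x + d → Z x ≡ x
    fixed-within zero x x-inner top≤x+0 =
      subst (λ t → Z t ≡ t) (≤-antisym (subst (top ≤_) (+-identityʳ x) top≤x+0) (inner-≤-top x-inner)) top-fixed
    fixed-within (suc d) x x-inner top≤x+d+1 with top ≤? x + d
    ... | yes top≤x+d = fixed-within d x x-inner top≤x+d
    ... | no top≰x+d with Z x <? suc x
    ...   | yes Zx<x+1 = proj₁ (ascent-fixed x (inner-< x+1-inner) (subst (Z x <_) (sym Zx+1≡x+1) Zx<x+1))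
      where
      x<n : x < n
      x<n = inner-< x-inner
      x+1-inner : Inner k (suc x)
      x+1-inner = inner-if-≤-top (≤-<-trans (proj₁ x-inner) x<n) (≤-trans (proj₁ x-inner) (n≤1+n x))
                                 (≤-trans (s≤s (m≤m+n x d)) (≰⇒> top≰x+d))
      Zx+1≡x+1 : Z (suc x) ≡ suc x
      Zx+1≡x+1 = fixed-within d (suc x) x+1-inner (subst (top ≤_) (+-suc x d) top≤x+d+1)
    ...   | no Zx≮x+1 = trans (sym (fixed-within d (Z x) (inner-closed o x-inner) top≤Zx+d))
                              (Z-involution x (inner-< x-inner))
      where
      top≤Zx+d : top ≤ Z x + d
      top≤Zx+d = ≤-trans top≤x+d+1 (≤-trans (≤-reflexive (+-suc x d)) (+-monoˡ-≤ d (≮⇒≥ Zx≮x+1)))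

  m≤n : m ≤ n
  m≤n = ≤-trans (m≤m+n m m) m+m≤n

  -- Below layer m, a fixed top n-1-k would make Inner k fixed, confining all
  -- 2-cycles to the outer k < m layers; so it cannot coexist with m ≤ K.
  top-not-fixed : ∀ {k} → k < m → Outer k → Z (n ∸ suc k) ≡ n ∸ suc k → m ≤ K → ⊥
  top-not-fixed {k} k<m o top-fixed m≤K =
    <⇒≱ k<m (≤-trans m≤K (K-upper k (openers-outer o (inner-fixed o top-fixed))))

  -- Layer k < m is reversed once the layers below it are: the partner i of the
  -- top n-1-k is inner; if i were above k, then i-1 < i would be an ascent
  -- (Z(i-1) < n-1-k = Z i), forcing the top to be fixed, which is impossible.
  reversed-step : ∀ {k} → k < m → Outer k → Reversed k
  reversed-step {k} k<m o = partner-of-top (Z top) refl (inner-closed o top-inner)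
    where
    top : ℕ
    top = n ∸ suc k
    k<n : k < n
    k<n = <-≤-trans k<m m≤n
    mir : Mirror n top k
    mir = mirror-of k<n
    top-inner : Inner k top
    top-inner = inner-if-≤-top k<n (<⇒≤ (mirror-below-half (mirror-sym {t = top} {u = k} mir) (≤-trans (+-mono-≤ k<m k<m) m+m≤n))) ≤-refl
    ZZtop : Z (Z top) ≡ top
    ZZtop = Z-involution top (inner-< top-inner)
    partner-of-top : ∀ i → Z top ≡ i → Inner k i → Reversed k
    partner-of-top i Ztop≡i i-inner with i ≟ k
    ... | yes refl = subst (Mirror n k) (sym (trans (cong Z (sym Ztop≡i)) ZZtop)) (mirror-sym {t = top} {u = k} mir)
    partner-of-top zero    _ i-inner | no 0≢k = ⊥-elim (0≢k (sym (n≤0⇒n≡0 (proj₁ i-inner))))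
    partner-of-top (suc i) Ztop≡i+1 i+1-inner | no i+1≢k = ⊥-elim (top-not-fixed k<m o top-fixed m≤K)
      where
      k≤i : k ≤ i
      k≤i = ℕ.s≤s⁻¹ (≤∧≢⇒< (proj₁ i+1-inner) (i+1≢k ∘ sym))
      i-inner : Inner k i
      i-inner = k≤i , <-trans (n<1+n (i + k)) (proj₂ i+1-inner)
      i+1<n : suc i < n
      i+1<n = inner-< i+1-inner
      Zi+1≡top : Z (suc i) ≡ top
      Zi+1≡top = trans (cong Z (sym Ztop≡i+1)) ZZtop
      Zi<top : Z i < top
      Zi<top = ≤∧≢⇒< (inner-≤-top (inner-closed o i-inner))
        (λ Zi≡top → 1+n≢n (sym (trans (sym (Z-involution i (inner-< i-inner))) (trans (cong Z Zi≡top) Ztop≡i+1))))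
      ascent : Z i ≡ i × Z (suc i) ≡ suc i × m ≤ K
      ascent = ascent-fixed i i+1<n (subst (Z i <_) (sym Zi+1≡top) Zi<top)
      top-fixed : Z top ≡ top
      top-fixed = trans Ztop≡i+1 (trans (sym (proj₁ (proj₂ ascent))) Zi+1≡top)
      m≤K : m ≤ K
      m≤K = proj₂ (proj₂ ascent)

  outer-reversed : ∀ k → k ≤ m → Outer k
  outer-reversed zero    _      t ()
  outer-reversed (suc k) k+1≤m t t<k+1 with t <? k
  ... | yes t<k = outer-reversed k (<⇒≤ k+1≤m) t t<k
  ... | no t≮k  = subst Reversed (≤-antisym (≮⇒≥ t≮k) (ℕ.s≤s⁻¹ t<k+1)) (reversed-step k+1≤m (outer-reversed k (<⇒≤ k+1≤m)))

  all-outer-reversed : Outer m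
  all-outer-reversed = outer-reversed m ≤-refl

  lower-reversed : ∀ k → k < m → Z k ≡ n ∸ suc k
  lower-reversed k k<m = mirror-≡ (all-outer-reversed k k<m)

  upper-reversed : ∀ k → k < n → n ≤ k + m → Z k ≡ n ∸ suc k
  upper-reversed k k<n n≤k+m = outer-partner all-outer-reversed (mirror-small mir n≤k+m) mir
    where
    mir : Mirror n (n ∸ suc k) k
    mir = mirror-of k<n

  -- Each of the lowest m positions opens a 2-cycle, its partner lying above half of n;
  -- so a further opener in the middle would give more than m 2-cycles.
  lower-openers : ∀ u → u < m → u < Z u
  lower-openers u u<m = mirror-below-half (all-outer-reversed u u<m) (≤-trans (+-mono-≤ u<m u<m) m+m≤n)

  middle-fixed : ∀ x → m ≤ x → x + m < n → Z x ≡ x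
  middle-fixed x m≤x x+m<n with <-cmp x (Z x)
  ... | tri≈ _ x≡Zx _ = sym x≡Zx
  ... | tri< x<Zx _ _ = ⊥-elim (<⇒≱ (K-lower m x m≤x x<n lower-openers x<Zx) K≤m)
    where
    x<n : x < n
    x<n = inner-< (m≤x , x+m<n)
  ... | tri> _ _ Zx<x = ⊥-elim (<⇒≱ (K-lower m (Z x) (proj₁ Zx-inner) (inner-< Zx-inner) lower-openers Zx<ZZx) K≤m)
    where
    Zx-inner : Inner m (Z x)
    Zx-inner = inner-closed all-outer-reversed (m≤x , x+m<n)
    Zx<ZZx : Z x < Z (Z x)
    Zx<ZZx = subst (Z x <_) (sym (Z-involution x (inner-< (m≤x , x+m<n)))) Zx<x

module Candidate (p q : ℕ) where

  n m : ℕ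
  n = p + q
  m = p ⊓ q

  w : Perm n
  w = wpq p q

  m+m≤n : m + m ≤ n
  m+m≤n = +-mono-≤ (m⊓n≤m p q) (m⊓n≤n p q)

  m≤n : m ≤ n
  m≤n = ≤-trans (m≤m+n m m) m+m≤n

  n≤k+m : ∀ {k} → n ∸ m ≤ k → n ≤ k + m
  n≤k+m {k} n-m≤k = subst (_≤ k + m) (m∸n+n≡m m≤n) (+-monoˡ-≤ m n-m≤k)

  below-upper : ∀ {k} → ¬ (n ∸ m ≤ k) → k + m < n
  below-upper {k} n-m≰k = subst (k + m <_) (m∸n+n≡m m≤n) (+-monoˡ-< m (≰⇒> n-m≰k))

  m≤n-m : m ≤ n ∸ m
  m≤n-m = subst (_≤ n ∸ m) (m+n∸n≡m m m) (∸-monoˡ-≤ m m+m≤n)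

  lower-below-upper : ∀ {k} → k < m → ¬ (n ∸ m ≤ k)
  lower-below-upper {k} k<m n-m≤k = <⇒≱ k<m (≤-trans m≤n-m n-m≤k)

  data Region (k : Fin n) : Set where
    outer  : (toℕ k < m ⊎ n ∸ m ≤ toℕ k) → app w k ≡ opposite k → Region k
    middle : ¬ (toℕ k < m) → ¬ (n ∸ m ≤ toℕ k) → app w k ≡ k → Region k

  region : ∀ k → Region k
  region k = classify (toℕ k <? m) (n ∸ m ≤? toℕ k) (lookup∘tabulate _ k)
    where
    classify : (lower? : Dec (toℕ k < m)) (upper? : Dec (n ∸ m ≤ toℕ k)) →
               app w k ≡ (if does lower? then opposite k else (if does upper? then opposite k else k)) → Region k
    classify (yes k<m) _             wk = outer (inj₁ k<m) wk
    classify (no _)    (yes n-m≤k)   wk = outer (inj₂ n-m≤k) wk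
    classify (no k≮m)  (no n-m≰k)    wk = middle k≮m n-m≰k wk

  opposite-mirror : ∀ k → Mirror n (toℕ k) (toℕ (opposite k))
  opposite-mirror k = begin
    suc (toℕ k + toℕ (opposite k))         ≡⟨ cong (λ t → suc (toℕ k + t)) (opposite-prop {n} k) ⟩
    suc (toℕ k + (n ∸ suc (toℕ k)))        ≡⟨ mirror-sym {n} {n ∸ suc (toℕ k)} (mirror-of (toℕ<n k)) ⟩
    n                                      ∎
    where open ≡-Reasoning

  outer-mirror : ∀ k → app w k ≡ opposite k → Mirror n (toℕ k) (toℕ (app w k))
  outer-mirror k wk = subst (λ t → Mirror n (toℕ k) (toℕ t)) (sym wk) (opposite-mirror k)

  lower→upper : ∀ k → toℕ k < m → n ∸ m ≤ toℕ (opposite k)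
  lower→upper k k<m = subst (n ∸ m ≤_) (sym (opposite-prop {n} k)) (∸-monoʳ-≤ n k<m)

  upper→lower : ∀ k → n ∸ m ≤ toℕ k → toℕ (opposite k) < m
  upper→lower k n-m≤k = mirror-small (mirror-sym {n} {toℕ k} (opposite-mirror k)) (n≤k+m n-m≤k)

  w-involution : IsInvolution w
  w-involution k with region k
  ... | middle _ _ wk = trans (cong (app w) wk) wk
  ... | outer out wk with region (app w k)
  ...   | outer _ wwk = trans wwk (trans (cong opposite wk) (opposite-involutive {n} k))
  ...   | middle ¬lower ¬upper _ with out
  ...     | inj₁ k<m    = ⊥-elim (¬upper (subst (λ t → n ∸ m ≤ toℕ t) (sym wk) (lower→upper k k<m)))
  ...     | inj₂ n-m≤k  = ⊥-elim (¬lower (subst (λ t → toℕ t < m) (sym wk) (upper→lower k n-m≤k)))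

  κ-w : κ w ≡ m
  κ-w = begin
    κ w                                     ≡⟨ κ-as-sum w ⟩
    sum (λ k → 𝟙 (k Fin.<? app w k))        ≡⟨ sum-cong-≗ {n} opener-iff-lower ⟩
    sum {n} (λ k → 𝟙 (toℕ k <? m))          ≡⟨ count-below n m ⟩
    n ⊓ m                                   ≡⟨ m≥n⇒m⊓n≡n m≤n ⟩
    m                                       ∎
    where
    open ≡-Reasoning
    opener-iff-lower : ∀ k → 𝟙 (k Fin.<? app w k) ≡ 𝟙 (toℕ k <? m)
    opener-iff-lower k with region k
    ... | middle k≮m _ wk = 𝟙-cong _ _ (λ k<wk → ⊥-elim (<-irrefl (cong toℕ (sym wk)) k<wk)) (λ k<m → ⊥-elim (k≮m k<m))
    ... | outer (inj₁ k<m) wk = 𝟙-cong _ _ (λ _ → k<m) (λ _ → subst (k Fin.<_) (sym wk)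
            (mirror-below-half (opposite-mirror k) (≤-trans (+-mono-≤ k<m k<m) m+m≤n)))
    ... | outer (inj₂ n-m≤k) wk = 𝟙-cong _ _
            (λ k<wk → ⊥-elim (<-asym k<wk (subst (Fin._< k) (sym wk) (<-≤-trans (upper→lower k n-m≤k) (≤-trans m≤n-m n-m≤k)))))
            (λ k<m → ⊥-elim (lower-below-upper k<m n-m≤k))

  -- Every ascent of w is a pair of (middle) fixed points: values of w are
  -- at least n-m on the lowest m positions, in [m, n-m) on the middle ones,
  -- below m on the highest m, and decreasing on the outer positions.
  module _ (j : ℕ) (h : suc j < n) where
    open Adjacent j h

    w-ascents-fixed : app w a Fin.< app w b → app w a ≡ a × app w b ≡ b
    w-ascents-fixed asc with region a | region b
    ... | middle _ _ wa | middle _ _ wb = wa , wb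
    ... | outer _ wa | outer _ wb =
      ⊥-elim (<-asym asc (mirror-antitone (outer-mirror a wa) (outer-mirror b wb) a<b))
    ... | outer (inj₁ a<m) wa | middle _ ¬b-upper wb =
      ⊥-elim (<-asym asc (subst₂ Fin._<_ (sym wb) (sym wa) (<-≤-trans (≰⇒> ¬b-upper) (lower→upper a a<m))))
    ... | outer (inj₂ a-upper) _ | middle _ ¬b-upper _ = ⊥-elim (¬b-upper (≤-trans a-upper (<⇒≤ a<b)))
    ... | middle ¬a-lower _ _ | outer (inj₁ b<m) _ = ⊥-elim (¬a-lower (<-trans a<b b<m))
    ... | middle ¬a-lower _ wa | outer (inj₂ b-upper) wb =
      ⊥-elim (<-asym asc (subst₂ Fin._<_ (sym wb) (sym wa) (<-≤-trans (upper→lower b b-upper) (≮⇒≥ ¬a-lower))))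

-- A permutation of Fin n read as a function on ℕ (the identity beyond n).
onℕ : ∀ {n} → Perm n → ℕ → ℕ
onℕ {n} z k with k <? n
... | yes k<n = toℕ (app z (fromℕ< k<n))
... | no _    = k

onℕ-toℕ : ∀ {n} (z : Perm n) (i : Fin n) → onℕ z (toℕ i) ≡ toℕ (app z i)
onℕ-toℕ {n} z i with toℕ i <? n
... | yes i<n = cong (λ t → toℕ (app z t)) (fromℕ<-toℕ i i<n)
... | no i≮n  = ⊥-elim (i≮n (toℕ<n i))

onℕ-fromℕ< : ∀ {n} (z : Perm n) k (k<n : k < n) → onℕ z k ≡ toℕ (app z (fromℕ< k<n))
onℕ-fromℕ< z k k<n = trans (cong (onℕ z) (sym (toℕ-fromℕ< k<n))) (onℕ-toℕ z _)

onℕ-bounded : ∀ {n} (z : Perm n) k → k < n → onℕ z k < n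
onℕ-bounded z k k<n = subst (_< _) (sym (onℕ-fromℕ< z k k<n)) (toℕ<n _)

onℕ-involution : ∀ {n} (z : Perm n) → IsInvolution z → ∀ k → k < n → onℕ z (onℕ z k) ≡ k
onℕ-involution z zz k k<n = begin
  onℕ z (onℕ z k)                            ≡⟨ cong (onℕ z) (onℕ-fromℕ< z k k<n) ⟩
  onℕ z (toℕ (app z (fromℕ< k<n)))           ≡⟨ onℕ-toℕ z _ ⟩
  toℕ (app z (app z (fromℕ< k<n)))           ≡⟨ cong toℕ (zz _) ⟩
  toℕ (fromℕ< k<n)                           ≡⟨ toℕ-fromℕ< k<n ⟩
  k                                          ∎
  where open ≡-Reasoning

κ-≤-if-openers-below : ∀ {n} (z : Perm n) k → (∀ t → t < n → t < onℕ z t → t < k) → κ z ≤ k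
κ-≤-if-openers-below {n} z k below = begin
  κ z                                ≡⟨ κ-as-sum z ⟩
  sum (λ t → 𝟙 (t Fin.<? app z t))   ≤⟨ sum-mono {n} (λ t → 𝟙-mono _ _ (opener-below t)) ⟩
  sum {n} (λ t → 𝟙 (toℕ t <? k))     ≡⟨ count-below n k ⟩
  n ⊓ k                              ≤⟨ m⊓n≤n n k ⟩
  k                                  ∎
  where
  open ≤-Reasoning
  opener-below : ∀ t → t Fin.< app z t → toℕ t < k
  opener-below t t<zt = below (toℕ t) (toℕ<n t) (subst (toℕ t <_) (sym (onℕ-toℕ z t)) t<zt)

κ->-if-openers-exceed : ∀ {n} (z : Perm n) k t → k ≤ t → t < n →
                        (∀ u → u < k → u < onℕ z u) → t < onℕ z t → suc k ≤ κ z
κ->-if-openers-exceed {n} z k t k≤t t<n lower t<zt = begin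
  suc k                                                        ≡⟨ +-comm 1 k ⟩
  k + 1                                                        ≡⟨ cong₂ _+_ lower-count (count-point tᶠ) ⟨
  sum {n} (λ u → 𝟙 (toℕ u <? k)) + sum (λ u → 𝟙 (u ≟ᶠ tᶠ))    ≡⟨ ∑-distrib-+ (λ u → 𝟙 (toℕ u <? k)) (λ u → 𝟙 (u ≟ᶠ tᶠ)) ⟨
  sum (λ u → 𝟙 (toℕ u <? k) + 𝟙 (u ≟ᶠ tᶠ))                    ≤⟨ sum-mono {n} disjoint-openers ⟩
  sum (λ u → 𝟙 (u Fin.<? app z u))                             ≡⟨ κ-as-sum z ⟨
  κ z                                                          ∎
  where
  open ≤-Reasoning
  tᶠ : Fin n
  tᶠ = fromℕ< t<n
  lower-count : sum {n} (λ u → 𝟙 (toℕ u <? k)) ≡ k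
  lower-count = trans (count-below n k) (m≥n⇒m⊓n≡n (≤-trans k≤t (<⇒≤ t<n)))
  disjoint-openers : ∀ u → 𝟙 (toℕ u <? k) + 𝟙 (u ≟ᶠ tᶠ) ≤ 𝟙 (u Fin.<? app z u)
  disjoint-openers u with u ≟ᶠ tᶠ
  ... | yes refl rewrite 𝟙-no (toℕ tᶠ <? k) (λ t<k → <⇒≱ t<k (subst (k ≤_) (sym (toℕ-fromℕ< t<n)) k≤t)) =
    ≤-reflexive (sym (𝟙-yes _ (subst₂ _<_ (sym (toℕ-fromℕ< t<n)) (onℕ-fromℕ< z t t<n) t<zt)))
  ... | no _ = subst (_≤ 𝟙 (u Fin.<? app z u)) (sym (+-identityʳ _))
    (𝟙-mono _ _ (λ u<k → subst (toℕ u <_) (onℕ-toℕ z u) (lower (toℕ u) u<k)))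

κ-step : ∀ {n} {x y : Perm n} → x ⋖ y → κ x ≤ κ y
κ-step {x = x} {y} (yy , j , h , x≡y∗s , shorter) with Adjacent.descent-step j h y x yy x≡y∗s shorter
... | inj₁ (_ , _ , κy≡1+κx) = subst (κ x ≤_) (sym κy≡1+κx) (n≤1+n (κ x))
... | inj₂ (κx≡κy , _)      = ≤-reflexive κx≡κy

κ-monotone : ∀ {n} {x y : Perm n} → x <ʷ y → κ x ≤ κ y
κ-monotone [ step ]       = κ-step step
κ-monotone (step ∷ chain) = ≤-trans (κ-step step) (κ-monotone chain)

first-step : ∀ {n} {x y : Perm n} → x <ʷ y → Σ (Perm n) λ x₁ → x ⋖ x₁ × κ x₁ ≤ κ y
first-step [ step ]       = _ , step , ≤-refl
first-step (step ∷ chain) = _ , step , κ-monotone chain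

module Maximum (p q : ℕ) where
  open Candidate p q

  -- A step up from w must join two fixed points into a 2-cycle, since w has
  -- no other ascents; so everything above w has more than m 2-cycles.
  above-w : ∀ {x} → w ⋖ x → κ x ≡ suc m
  above-w {x} (xx , j , h , w≡x∗s , shorter) with Adjacent.descent-step j h x w xx w≡x∗s shorter
  ... | inj₁ (_ , _ , κx≡1+κw)    = trans κx≡1+κw (cong suc κ-w)
  ... | inj₂ (_ , asc , not-fixed) = ⊥-elim (not-fixed (w-ascents-fixed j h asc))

  w-maximal : ∀ z → InIpq p q z → ¬ (w <ʷ z)
  w-maximal z (_ , κz≤m) chain with first-step chain
  ... | x₁ , w⋖x₁ , κx₁≤κz = 1+n≰n (≤-trans (≤-reflexive (sym (above-w w⋖x₁))) (≤-trans κx₁≤κz κz≤m))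

  -- At an ascent of a maximal z, z ∗ s_j lies above z and so must leave
  -- I_{p,q}: the ascent joins two fixed points, and κ z = m already.
  module _ (z : Perm n) (z-max : IsMaximalIpq p q z) (j : ℕ) (h : suc j < n) where
    open Adjacent j h

    zz : IsInvolution z
    zz = proj₁ (proj₁ z-max)

    leaves-Ipq : app z a Fin.< app z b → ¬ (κ ((z ∗s j) h) ≤ m)
    leaves-Ipq asc κy≤m = proj₂ z-max _ (proj₁ (∗-involution z zz) , κy≤m)
      [ proj₁ (∗-involution z zz) , j , h , sym (proj₂ (∗-involution z zz)) , proj₁ (ascent-step z zz asc) ]

    maximal-ascents : app z a Fin.< app z b → app z a ≡ a × app z b ≡ b × m ≤ κ z
    maximal-ascents asc with ascent-step z zz asc
    ... | _ , inj₂ κy≡κz = ⊥-elim (leaves-Ipq asc (subst (_≤ m) (sym κy≡κz) (proj₂ (proj₁ z-max))))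
    ... | _ , inj₁ (za , zb , κy≡1+κz) with m ≤? κ z
    ...   | yes m≤κz = za , zb , m≤κz
    ...   | no m≰κz  = ⊥-elim (leaves-Ipq asc (subst (_≤ m) (sym κy≡1+κz) (≰⇒> m≰κz)))

  -- A maximal z satisfies the hypotheses of Rigidity, whose conclusions say
  -- that z agrees with w in every region.
  maximal-unique : ∀ z → IsMaximalIpq p q z → z ≡ w
  maximal-unique z z-max = perm-ext λ k → toℕ-injective (agree k (region k))
    where
    Z : ℕ → ℕ
    Z = onℕ z

    ascent-fixed : ∀ j → suc j < n → Z j < Z (suc j) → Z j ≡ j × Z (suc j) ≡ suc j × m ≤ κ z
    ascent-fixed j h asc = on-a , on-b , proj₂ (proj₂ fin-ascent)
      where
      open Adjacent j h
      Za : Z j ≡ toℕ (app z a)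
      Za = trans (cong Z (sym toℕ-a)) (onℕ-toℕ z a)
      Zb : Z (suc j) ≡ toℕ (app z b)
      Zb = trans (cong Z (sym toℕ-b)) (onℕ-toℕ z b)
      fin-ascent : app z a ≡ a × app z b ≡ b × m ≤ κ z
      fin-ascent = maximal-ascents z z-max j h (subst₂ _<_ Za Zb asc)
      on-a : Z j ≡ j
      on-a = trans Za (trans (cong toℕ (proj₁ fin-ascent)) toℕ-a)
      on-b : Z (suc j) ≡ suc j
      on-b = trans Zb (trans (cong toℕ (proj₁ (proj₂ fin-ascent))) toℕ-b)

    open Rigidity n m m+m≤n Z (κ z) (onℕ-bounded z) (onℕ-involution z (proj₁ (proj₁ z-max))) ascent-fixed (proj₂ (proj₁ z-max))
                  (κ-≤-if-openers-below z) (κ->-if-openers-exceed z)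

    reversed-at : ∀ k → Z (toℕ k) ≡ n ∸ suc (toℕ k) → app w k ≡ opposite k → toℕ (app z k) ≡ toℕ (app w k)
    reversed-at k Zk wk = trans (sym (onℕ-toℕ z k)) (trans Zk (sym (trans (cong toℕ wk) (opposite-prop {n} k))))

    agree : ∀ k → Region k → toℕ (app z k) ≡ toℕ (app w k)
    agree k (outer (inj₁ k<m) wk)   = reversed-at k (lower-reversed (toℕ k) k<m) wk
    agree k (outer (inj₂ n-m≤k) wk) = reversed-at k (upper-reversed (toℕ k) (toℕ<n k) (n≤k+m n-m≤k)) wk
    agree k (middle k≮m n-m≰k wk)   =
      trans (sym (onℕ-toℕ z k)) (trans (middle-fixed (toℕ k) (≮⇒≥ k≮m) (below-upper n-m≰k)) (cong toℕ (sym wk)))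

mainTheorem19 : (p q : ℕ) →
    IsMaximalIpq p q (wpq p q) × (∀ z → IsMaximalIpq p q z → z ≡ wpq p q)
mainTheorem19 p q = ((w-involution , ≤-reflexive κ-w) , w-maximal) , maximal-unique
  where
  open Candidate p q
  open Maximum p q
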